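{- Let $G$ be a directed graph and suppose $b\in L(G)$ mentions the tuple $\bar a$. Then $b$ lies in a maximal discrete interval of $L(G)$ of some finite size $m\ge1$, namely the $m$ for which $\bar a$ realizes $t_m$; thus the number $m$ determines the atomic type of $\bar a$, and in particular the length of $\bar a$.
   Context: A directed graph is $G=(V,E)$ with $E$ binary and $V\subseteq\omega$. Fix an effective partition $(A_n)_{n\in\omega}$ of $\mathbb{Q}$ into pairwise disjoint dense sets, and an effective list $(t_m)_{1\le m<\omega}$ of all atomic types in $\{E\}$ of tuples of distinct elements, with $t_1$ the type of the empty tuple, then types of single elements, then of pairs, then triples, etc. $L(G)$ is the set of finite sequences of rationals $r_0q_1r_1\ldots r_{n-1}q_nr_nk$ ($n\ge0$) with $r_i\in A_0$ ($i<n$), $r_n\in A_1$, distinct $a_1,\dots,a_n\in V$ with $q_i\in A_{a_i}$ and $(a_1,\dots,a_n)$ realizing $t_m$ in $G$, and $k\in\omega$, $k<m$; ordered lexicographically. Such an element mentions $(a_1,\dots,a_n)$. The maximal discrete interval of $x\in L(G)$ is the set of all $y$ such that only finitely many elements lie between $x$ and $y$. -}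

module Defs where

open import Data.Nat using (ℕ; zero; suc; _≤_; _<_)
open import Data.Integer using (+_)
open import Data.Rational as ℚ using (ℚ; _/_)
open import Data.Fin using (Fin)
open import Data.Bool using (Bool; true)
open import Data.Vec using (Vec; []; _∷_; lookup)
open import Data.List using (List; []; _∷_; length)
open import Data.List.Membership.Propositional using (_∈_)
open import Data.List.Relation.Unary.Unique.Propositional using (Unique)
open import Data.List.Relation.Binary.Lex.Strict using (Lex-<)
open import Data.Product using (Σ; ∃; ∃-syntax; _×_; _,_)
open import Data.Sum using (_⊎_)
open import Relation.Binary.PropositionalEquality using (_≡_; _≢_; subst)

record DiGraph : Set₁ where
  field
    V : ℕ → Set
    E : ℕ → ℕ → Set
open DiGraph public

-- Atomic types in {E} of n-tuples of DISTINCT elements.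
-- Since equality atoms are fixed (all distinct), such a type is
-- determined by its length n and the n×n table telling, for each
-- (i , j), whether E(x_i , x_j) holds (i = j allowed: loops).

AtomicType : Set
AtomicType = Σ ℕ (λ n → Vec (Vec Bool n) n)


typeLength : AtomicType → ℕ
typeLength (n , _) = n


RealizesTable : (G : DiGraph) {n : ℕ} → Vec ℕ n → Vec (Vec Bool n) n → Set
RealizesTable G a M =
    (∀ (i j : Fin _) → i ≢ j → lookup a i ≢ lookup a j)
  × (∀ (i : Fin _) → V G (lookup a i))
  × (∀ (i j : Fin _) →
        (E G (lookup a i) (lookup a j) → lookup (lookup M i) j ≡ true)
      × (lookup (lookup M i) j ≡ true → E G (lookup a i) (lookup a j)))

Realizes : (G : DiGraph) {n : ℕ} → Vec ℕ n → AtomicType → Set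
Realizes G {n} a (n' , M) =
  Σ (n' ≡ n) λ eq → RealizesTable G a (subst (λ k → Vec (Vec Bool k) k) eq M)

-- The fixed data: a partition (A_n) of ℚ into pairwise disjoint dense
-- sets, given by the index function  part  (q ∈ A_n  iff  part q ≡ n),
-- and a listing (t_m)_{m ≥ 1} of all atomic types, with t_1 the empty
-- type and then ordered by non-decreasing length.  (The value t 0 is
-- irrelevant.)  Every Agda function is computable, so "effective" is
-- automatic.

record Partition : Set where
  field
    part  : ℚ → ℕ
    dense : ∀ (n : ℕ) (p q : ℚ) → p ℚ.< q →
            ∃[ r ] (p ℚ.< r × r ℚ.< q × part r ≡ n)
open Partition public

record TypeListing : Set where
  field
    t        : ℕ → AtomicType
    t-surj   : ∀ (τ : AtomicType) → ∃[ m ] (1 ≤ m × t m ≡ τ)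
    t-inj    : ∀ (m m' : ℕ) → 1 ≤ m → 1 ≤ m' → t m ≡ t m' → m ≡ m'
    t-first  : t 1 ≡ (0 , [])
    t-mono   : ∀ (m m' : ℕ) → 1 ≤ m → m ≤ m' →
               typeLength (t m) ≤ typeLength (t m')
open TypeListing public

ℕtoℚ : ℕ → ℚ
ℕtoℚ k = (+ k) / 1

-- encode r_0 .. r_{n-1}, q_1 .. q_n, r_n, k  as the sequence
-- r_0 q_1 r_1 ... r_{n-1} q_n r_n k
encode : {n : ℕ} → Vec ℚ n → Vec ℚ n → ℚ → ℕ → List ℚ
encode []       []       rn k = rn ∷ ℕtoℚ k ∷ []
encode (r ∷ rs) (q ∷ qs) rn k = r ∷ q ∷ encode rs qs rn k

-- b ∈ L(G) and b mentions the tuple a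
Mentions : Partition → TypeListing → DiGraph → List ℚ → {n : ℕ} → Vec ℕ n → Set
Mentions P T G b {n} a =
  Σ (Vec ℚ n) λ rs → Σ (Vec ℚ n) λ qs → Σ ℚ λ rn → Σ ℕ λ m → Σ ℕ λ k →
      (∀ (i : Fin n) → part P (lookup rs i) ≡ 0)
    × part P rn ≡ 1
    × (∀ (i : Fin n) → part P (lookup qs i) ≡ lookup a i)
    × 1 ≤ m
    × Realizes G a (t T m)
    × k < m
    × b ≡ encode rs qs rn k

InL : Partition → TypeListing → DiGraph → List ℚ → Set
InL P T G x = Σ ℕ λ n → Σ (Vec ℕ n) λ a → Mentions P T G x a

-- lexicographic order on finite sequences of rationals
-- (a proper initial segment is smaller)
_<L_ : List ℚ → List ℚ → Set
_<L_ = Lex-< _≡_ ℚ._<_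

Between : List ℚ → List ℚ → List ℚ → Set
Between x y z = (x <L z × z <L y) ⊎ (y <L z × z <L x)

-- y is in the maximal discrete interval of x in L(G):
-- y ∈ L(G) and only finitely many elements of L(G) lie between x and y
InMaxDiscreteInterval : Partition → TypeListing → DiGraph →
                        List ℚ → List ℚ → Set
InMaxDiscreteInterval P T G x y =
  InL P T G y ×
  ∃[ l ] (∀ z → InL P T G z → Between x y z → z ∈ l)

MaxDiscreteIntervalSize : Partition → TypeListing → DiGraph →
                          List ℚ → ℕ → Set
MaxDiscreteIntervalSize P T G x m =
  ∃[ l ] ( Unique l × length l ≡ m
         × (∀ y → (y ∈ l → InMaxDiscreteInterval P T G x y)
                × (InMaxDiscreteInterval P T G x y → y ∈ l)))

-- Write b = r₀ q₁ r₁ … q_n r_n k and call (r̄ , q̄ , r_n) the frame of b.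
-- The interval is the block  x_j = r₀ q₁ … q_n r_n j  (j < m), which lies in
-- L(G) and has m distinct elements.
--   * Between two members of the block there are only members of the block
--     (between-block), so the whole block lies in the interval.
--   * If y ∈ L(G) has a different frame, look at the first position where b
--     and y differ: by density of the classes A_i the smaller of the two can
--     be changed there, inside its class, to a rational outside any given
--     finite set S (gap / separate).  This yields elements of L(G) between b
--     and y avoiding every finite S, so infinitely many, and y is not in the
--     interval.  If y has the same frame it mentions the same tuple, so its
--     type index is m (a tuple realizes one atomic type and the listing is
--     injective), and y belongs to the block.
module Submission where

open import Defs
open import Data.Nat as ℕ using (ℕ; _≤_)
open import Data.Nat.Properties as ℕP using ()
open import Data.Integer as ℤ using (+_)
import Data.Integer.Properties as ℤP
open import Data.Nat.Coprimality as Coprimality using ()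
open import Data.Rational as ℚ using (ℚ; mkℚ; ↥_)
import Data.Rational.Properties as ℚP
open import Data.Fin using (zero; suc)
open import Data.Bool using (Bool; true; false)
open import Data.Vec using (Vec; []; _∷_; lookup)
open import Data.Vec.Properties using (tabulate∘lookup; tabulate-cong)
open import Data.List using (List; []; _∷_; concat; applyUpTo)
open import Data.List.Properties using (length-applyUpTo; ∷-injective; ∷-injectiveˡ; ∷-injectiveʳ)
open import Data.List.Membership.Propositional using (_∈_; _∉_)
open import Data.List.Membership.Propositional.Properties
  using (∈-concat⁺′; ∈-applyUpTo⁺; ∈-applyUpTo⁻)
open import Data.List.Relation.Unary.Any using (here; there)
open import Data.List.Relation.Unary.Unique.Propositional using (Unique)
open import Data.List.Relation.Unary.Unique.Propositional.Properties using (applyUpTo⁺₁)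
open import Data.List.Relation.Binary.Lex.Strict using (this; next; base; <-compare)
open import Data.List.Relation.Binary.Pointwise using (Pointwise-≡⇒≡)
open import Data.Product using (Σ; _×_; _,_; proj₁; proj₂)
open import Data.Sum as Sum using (_⊎_; inj₁; inj₂)
open import Data.Empty using (⊥-elim)
open import Relation.Nullary using (yes; no)
open import Relation.Binary using (tri<; tri≈; tri>)
open import Relation.Binary.PropositionalEquality
open import Function using (_∘_)

-- The rational ℕtoℚ k is the normal form k/1; hence ℕtoℚ is injective and
-- reflects the order (needed for the last entry k of an encoding).
ℕtoℚ-normal : ∀ k → ℕtoℚ k ≡ mkℚ (+ k) 0 (Coprimality.sym (Coprimality.1-coprimeTo k))
ℕtoℚ-normal k = ℚP.normalize-coprime _

ℕtoℚ-injective : ∀ {j k} → ℕtoℚ j ≡ ℕtoℚ k → j ≡ k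
ℕtoℚ-injective {j} {k} eq =
  ℤP.+-injective (cong ↥_ (trans (sym (ℕtoℚ-normal j)) (trans eq (ℕtoℚ-normal k))))

ℕtoℚ-cancel-< : ∀ {j k} → ℕtoℚ j ℚ.< ℕtoℚ k → j ℕ.< k
ℕtoℚ-cancel-< {j} {k} j<k with subst₂ ℚ._<_ (ℕtoℚ-normal j) (ℕtoℚ-normal k) j<k
... | ℚ.*<* j*1<k*1 =
  ℤP.drop‿+<+ (subst₂ ℤ._<_ (ℤP.*-identityʳ (+ j)) (ℤP.*-identityʳ (+ k)) j*1<k*1)

vec-ext : ∀ {A : Set} {n} {u v : Vec A n} → (∀ i → lookup u i ≡ lookup v i) → u ≡ v
vec-ext {u = u} {v} same =
  trans (sym (tabulate∘lookup u)) (trans (tabulate-cong same) (tabulate∘lookup v))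

lex-squeeze : ∀ {u v : ℚ} {us vs ws} → (u ∷ us) <L (v ∷ vs) → (v ∷ vs) <L (u ∷ ws) →
              u ≡ v × us <L vs × vs <L ws
lex-squeeze (this u<v)     (this v<u)     = ⊥-elim (ℚP.<-asym u<v v<u)
lex-squeeze (this u<v)     (next v≡u _)   = ⊥-elim (ℚP.<-irrefl (sym v≡u) u<v)
lex-squeeze (next u≡v _)   (this v<u)     = ⊥-elim (ℚP.<-irrefl (sym u≡v) v<u)
lex-squeeze (next u≡v u<v) (next _ v<w)   = u≡v , u<v , v<w

bool-ext : ∀ {b c : Bool} → (b ≡ true → c ≡ true) → (c ≡ true → b ≡ true) → b ≡ c
bool-ext {true}  {true}  _ _ = refl
bool-ext {false} {false} _ _ = refl
bool-ext {true}  {false} b⇒c _ = sym (b⇒c refl)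
bool-ext {false} {true}  _ c⇒b = c⇒b refl

realizes-unique : (G : DiGraph) {n : ℕ} (a : Vec ℕ n) {τ τ' : AtomicType} →
                  Realizes G a τ → Realizes G a τ' → τ ≡ τ'
realizes-unique G a {n , M} {_ , M'} (refl , _ , _ , edges) (refl , _ , _ , edges') =
  cong (n ,_) (vec-ext λ i → vec-ext λ j →
    bool-ext (proj₁ (edges' i j) ∘ proj₂ (edges i j))
             (proj₁ (edges i j) ∘ proj₂ (edges' i j)))

listing-index-unique : (T : TypeListing) (G : DiGraph) {n : ℕ} (a : Vec ℕ n) {m m' : ℕ} →
                       1 ≤ m → Realizes G a (t T m) → 1 ≤ m' → Realizes G a (t T m') → m ≡ m'
listing-index-unique T G a {m} {m'} 1≤m real 1≤m' real' =
  t-inj T m m' 1≤m 1≤m' (realizes-unique G a real real')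

module Encodings (P : Partition) where

  class-clash : ∀ {u v} → part P u ≡ 0 → part P v ≡ 1 → u ≢ v
  class-clash u∈A₀ v∈A₁ refl = ℕP.0≢1+n (trans (sym u∈A₀) v∈A₁)

  ∉-∷ : ∀ {w s : ℚ} {S} → w ≢ s → w ∉ S → w ∉ s ∷ S
  ∉-∷ w≢s _   (here w≡s)  = w≢s w≡s
  ∉-∷ _   w∉S (there w∈S) = w∉S w∈S

  -- Each class is dense, so it meets every interval outside any finite S:
  -- avoid S first; if the witness is the new point s, search again below s.
  fresh-in-class : ∀ c {lo hi} → lo ℚ.< hi → (S : List ℚ) →
                   Σ ℚ λ w → lo ℚ.< w × w ℚ.< hi × part P w ≡ c × w ∉ S
  fresh-in-class c lo<hi [] with dense P c _ _ lo<hi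
  ... | w , lo<w , w<hi , w∈c = w , lo<w , w<hi , w∈c , λ ()
  fresh-in-class c lo<hi (s ∷ S) with fresh-in-class c lo<hi S
  ... | w , lo<w , w<hi , w∈c , w∉S with w ℚP.≟ s
  ...   | no w≢s = w , lo<w , w<hi , w∈c , ∉-∷ w≢s w∉S
  ...   | yes refl with fresh-in-class c lo<w S
  ...     | v , lo<v , v<w , v∈c , v∉S =
    v , lo<v , ℚP.<-trans v<w w<hi , v∈c , ∉-∷ (λ v≡w → ℚP.<-irrefl v≡w v<w) v∉S

  WellFormed : ∀ {n} → Vec ℚ n → ℚ → Set
  WellFormed rs rn = (∀ i → part P (lookup rs i) ≡ 0) × part P rn ≡ 1

  wf-head : ∀ {n r rn} {rs : Vec ℚ n} → WellFormed (r ∷ rs) rn → part P r ≡ 0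
  wf-head (rs∈A₀ , _) = rs∈A₀ zero

  wf-tail : ∀ {n r rn} {rs : Vec ℚ n} → WellFormed (r ∷ rs) rn → WellFormed rs rn
  wf-tail (rs∈A₀ , rn∈A₁) = rs∈A₀ ∘ suc , rn∈A₁

  wf-∷ : ∀ {n r rn} {rs : Vec ℚ n} → part P r ≡ 0 → WellFormed rs rn → WellFormed (r ∷ rs) rn
  wf-∷ r∈A₀ (rs∈A₀ , rn∈A₁) = (λ { zero → r∈A₀ ; (suc i) → rs∈A₀ i }) , rn∈A₁

  SameFrame : ∀ {n n'} → Vec ℚ n → Vec ℚ n → ℚ → Vec ℚ n' → Vec ℚ n' → ℚ → Set
  SameFrame {n} {n'} rs qs rn rs' qs' rn' =
    _≡_ {A = Σ ℕ λ l → Vec ℚ l × Vec ℚ l × ℚ} (n , rs , qs , rn) (n' , rs' , qs' , rn')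

  encode-nonempty : ∀ {n} (rs qs : Vec ℚ n) rn k → encode rs qs rn k ≢ []
  encode-nonempty []      []      _ _ ()
  encode-nonempty (_ ∷ _) (_ ∷ _) _ _ ()

  encode-injective : ∀ {n n'} (rs qs : Vec ℚ n) rn k (rs' qs' : Vec ℚ n') rn' k' →
                     encode rs qs rn k ≡ encode rs' qs' rn' k' →
                     SameFrame rs qs rn rs' qs' rn' × k ≡ k'
  encode-injective [] [] rn k [] [] rn' k' eq with ∷-injective eq
  ... | refl , eq' = refl , ℕtoℚ-injective (∷-injectiveˡ eq')
  encode-injective [] [] rn k (_ ∷ rs') (_ ∷ qs') rn' k' eq =
    ⊥-elim (encode-nonempty rs' qs' rn' k' (sym (∷-injectiveʳ (∷-injectiveʳ eq))))
  encode-injective (_ ∷ rs) (_ ∷ qs) rn k [] [] rn' k' eq =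
    ⊥-elim (encode-nonempty rs qs rn k (∷-injectiveʳ (∷-injectiveʳ eq)))
  encode-injective (r ∷ rs) (q ∷ qs) rn k (r' ∷ rs') (q' ∷ qs') rn' k' eq
    with ∷-injective eq
  ... | refl , eq' with ∷-injective eq'
  ...   | refl , eq'' with encode-injective rs qs rn k rs' qs' rn' k' eq''
  ...     | refl , k≡k' = refl , k≡k'

  between-block : ∀ {n n'} (rs qs : Vec ℚ n) rn (rs' qs' : Vec ℚ n') rn' {k j k'} →
                  WellFormed rs rn → WellFormed rs' rn' →
                  encode rs qs rn k <L encode rs' qs' rn' k' →
                  encode rs' qs' rn' k' <L encode rs qs rn j →
                  SameFrame rs qs rn rs' qs' rn' × k' ℕ.< j
  between-block (r ∷ rs) (q ∷ qs) rn (r' ∷ rs') (q' ∷ qs') rn' wf wf' lo hi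
    with lex-squeeze lo hi
  ... | refl , lo₁ , hi₁ with lex-squeeze lo₁ hi₁
  ...   | refl , lo₂ , hi₂ with between-block rs qs rn rs' qs' rn' (wf-tail wf) (wf-tail wf') lo₂ hi₂
  ...     | refl , k'<j = refl , k'<j
  between-block (r ∷ rs) (q ∷ qs) rn [] [] rn' wf wf' lo hi =
    ⊥-elim (class-clash (wf-head wf) (proj₂ wf') (proj₁ (lex-squeeze lo hi)))
  between-block [] [] rn (r' ∷ rs') (q' ∷ qs') rn' wf wf' lo hi =
    ⊥-elim (class-clash (wf-head wf') (proj₂ wf) (sym (proj₁ (lex-squeeze lo hi))))
  between-block [] [] rn [] [] rn' wf wf' lo hi with lex-squeeze lo hi
  ... | refl , _ , this k'<j        = refl , ℕtoℚ-cancel-< k'<j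
  ... | refl , _ , next _ (base ())

  -- z is obtained from an encoding with entries qs and last entry k by
  -- moving every entry inside its class; it then mentions the same tuple.
  Sibling : ∀ {n} → Vec ℚ n → ℕ → List ℚ → Set
  Sibling {n} qs k z = Σ (Vec ℚ n) λ rs' → Σ (Vec ℚ n) λ qs' → Σ ℚ λ rn' →
    WellFormed rs' rn' × (∀ i → part P (lookup qs' i) ≡ part P (lookup qs i)) ×
    z ≡ encode rs' qs' rn' k

  record FreshBetween {n} (qs : Vec ℚ n) (k : ℕ) (x y S : List ℚ) : Set where
    constructor fresh-between
    field
      z       : List ℚ
      sibling : Sibling qs k z
      x<z     : x <L z
      z<y     : z <L y
      w       : ℚ
      w∈z     : w ∈ z
      w∉S     : w ∉ S

  fresh-between-∷ : ∀ {n} {qs : Vec ℚ n} {k x y S} r q → part P r ≡ 0 →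
                    FreshBetween qs k x y S → FreshBetween (q ∷ qs) k (r ∷ q ∷ x) (r ∷ q ∷ y) S
  fresh-between-∷ r q r∈A₀ (fresh-between z (rs' , qs' , rn' , wf , same , refl) x<z z<y w w∈z w∉S) =
    fresh-between (r ∷ q ∷ z)
      (r ∷ rs' , q ∷ qs' , rn' , wf-∷ r∈A₀ wf , (λ { zero → refl ; (suc i) → same i }) , refl)
      (next refl (next refl x<z)) (next refl (next refl z<y)) w (there (there w∈z)) w∉S

  lead : ∀ {n} → Vec ℚ n → ℚ → ℚ
  lead []      rn = rn
  lead (r ∷ _) _  = r

  -- If the first entry of x is below v, replace it by a fresh rational of
  -- its class between the two.
  fresh-lead : ∀ {n} (rs qs : Vec ℚ n) rn k → WellFormed rs rn → (S : List ℚ) →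
               ∀ {v ys} → lead rs rn ℚ.< v → FreshBetween qs k (encode rs qs rn k) (v ∷ ys) S
  fresh-lead [] [] rn k wf S rn<v with fresh-in-class 1 rn<v S
  ... | w , rn<w , w<v , w∈A₁ , w∉S =
    fresh-between (w ∷ ℕtoℚ k ∷ []) ([] , [] , w , ((λ ()) , w∈A₁) , (λ ()) , refl)
      (this rn<w) (this w<v) w (here refl) w∉S
  fresh-lead (r ∷ rs) (q ∷ qs) rn k wf S r<v with fresh-in-class 0 r<v S
  ... | w , r<w , w<v , w∈A₀ , w∉S =
    fresh-between (w ∷ q ∷ encode rs qs rn k)
      (w ∷ rs , q ∷ qs , rn , wf-∷ w∈A₀ (wf-tail wf) , (λ _ → refl) , refl)
      (this r<w) (this w<v) w (here refl) w∉S

  -- If x and y first differ in q₁, replace q₁ by a fresh rational of its class.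
  fresh-second : ∀ {n} r q (rs qs : Vec ℚ n) rn k → WellFormed (r ∷ rs) rn → (S : List ℚ) →
                 ∀ {v ys} → q ℚ.< v → FreshBetween (q ∷ qs) k (encode (r ∷ rs) (q ∷ qs) rn k) (r ∷ v ∷ ys) S
  fresh-second r q rs qs rn k wf S q<v with fresh-in-class (part P q) q<v S
  ... | w , q<w , w<v , w∈Aq , w∉S =
    fresh-between (r ∷ w ∷ encode rs qs rn k)
      (r ∷ rs , w ∷ qs , rn , wf , (λ { zero → w∈Aq ; (suc i) → refl }) , refl)
      (next refl (this q<w)) (next refl (this w<v)) w (there (here refl)) w∉S

  gap : ∀ {n n'} (rs qs : Vec ℚ n) rn k (rs' qs' : Vec ℚ n') rn' k' →
        WellFormed rs rn → WellFormed rs' rn' → (S : List ℚ) →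
        encode rs qs rn k <L encode rs' qs' rn' k' →
        SameFrame rs qs rn rs' qs' rn' ⊎ FreshBetween qs k (encode rs qs rn k) (encode rs' qs' rn' k') S
  gap rs@(_ ∷ _) qs@(_ ∷ _) rn k (_ ∷ _) (_ ∷ _) _ _ wf _ S (this r<r') =
    inj₂ (fresh-lead rs qs rn k wf S r<r')
  gap (r ∷ rs) (q ∷ qs) rn k (_ ∷ _) (_ ∷ _) _ _ wf _ S (next refl (this q<q')) =
    inj₂ (fresh-second r q rs qs rn k wf S q<q')
  gap (r ∷ rs) (q ∷ qs) rn k (_ ∷ rs') (_ ∷ qs') rn' k' wf wf' S (next refl (next refl x<y))
    with gap rs qs rn k rs' qs' rn' k' (wf-tail wf) (wf-tail wf') S x<y
  ... | inj₁ refl    = inj₁ refl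
  ... | inj₂ between = inj₂ (fresh-between-∷ r q (wf-head wf) between)
  gap rs@(_ ∷ _) qs@(_ ∷ _) rn k [] [] _ _ wf _ S (this r<rn') =
    inj₂ (fresh-lead rs qs rn k wf S r<rn')
  gap (_ ∷ _) (_ ∷ _) _ _ [] [] _ _ wf wf' _ (next r≡rn' _) =
    ⊥-elim (class-clash (wf-head wf) (proj₂ wf') r≡rn')
  gap [] [] rn k (_ ∷ _) (_ ∷ _) _ _ wf _ S (this rn<r') =
    inj₂ (fresh-lead [] [] rn k wf S rn<r')
  gap [] [] _ _ (_ ∷ _) (_ ∷ _) _ _ wf wf' _ (next rn≡r' _) =
    ⊥-elim (class-clash (wf-head wf') (proj₂ wf) (sym rn≡r'))
  gap [] [] rn k [] [] _ _ wf _ S (this rn<rn') =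
    inj₂ (fresh-lead [] [] rn k wf S rn<rn')
  gap [] [] _ _ [] [] _ _ _ _ _ (next refl _) = inj₁ refl

  separate : ∀ {n n'} (rs qs : Vec ℚ n) rn k (rs' qs' : Vec ℚ n') rn' k' →
             WellFormed rs rn → WellFormed rs' rn' → (S : List ℚ) →
             SameFrame rs qs rn rs' qs' rn'
             ⊎ FreshBetween qs k (encode rs qs rn k) (encode rs' qs' rn' k') S
             ⊎ FreshBetween qs' k' (encode rs' qs' rn' k') (encode rs qs rn k) S
  separate rs qs rn k rs' qs' rn' k' wf wf' S
    with <-compare sym ℚP.<-cmp (encode rs qs rn k) (encode rs' qs' rn' k')
  ... | tri< x<y _ _ = Sum.map₂ inj₁ (gap rs qs rn k rs' qs' rn' k' wf wf' S x<y)
  ... | tri≈ _ x≈y _ = inj₁ (proj₁ (encode-injective rs qs rn k rs' qs' rn' k' (Pointwise-≡⇒≡ x≈y)))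
  ... | tri> _ _ y<x = Sum.map sym inj₂ (gap rs' qs' rn' k' rs qs rn k wf' wf S y<x)

open Encodings

sibling∈L : (P : Partition) (T : TypeListing) (G : DiGraph) {n : ℕ} {a : Vec ℕ n}
            {qs : Vec ℚ n} {k m : ℕ} {z : List ℚ} →
            (∀ i → part P (lookup qs i) ≡ lookup a i) → 1 ≤ m → Realizes G a (t T m) →
            k ℕ.< m → Sibling P qs k z → InL P T G z
sibling∈L P T G {n} {a} classes 1≤m real k<m (rs' , qs' , rn' , (rs∈A₀ , rn∈A₁) , same , refl) =
  n , a , rs' , qs' , rn' , _ , _ , rs∈A₀ , rn∈A₁ , (λ i → trans (same i) (classes i)) ,
  1≤m , real , k<m , refl

module Block (P : Partition) (T : TypeListing) (G : DiGraph)
             {n : ℕ} {a : Vec ℕ n} {rs qs : Vec ℚ n} {rn : ℚ} {m : ℕ}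
             (wf : WellFormed P rs rn) (classes : ∀ i → part P (lookup qs i) ≡ lookup a i)
             (1≤m : 1 ≤ m) (real : Realizes G a (t T m)) where

  block : List (List ℚ)
  block = applyUpTo (encode rs qs rn) m

  block-unique : Unique block
  block-unique = applyUpTo⁺₁ _ m λ i<j _ xᵢ≡xⱼ →
    ℕP.<-irrefl (proj₂ (encode-injective P rs qs rn _ rs qs rn _ xᵢ≡xⱼ)) i<j

  block⊆interval : ∀ {k} → k ℕ.< m → ∀ y → y ∈ block →
                   InMaxDiscreteInterval P T G (encode rs qs rn k) y
  block⊆interval {k} k<m y y∈block with ∈-applyUpTo⁻ _ y∈block
  ... | j , j<m , refl = sibling∈L P T G {a = a} {qs} classes 1≤m real j<m (rs , qs , rn , wf , (λ _ → refl) , refl) ,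
                         block , within
    where
    within : ∀ z → InL P T G z → Between (encode rs qs rn k) (encode rs qs rn j) z → z ∈ block
    within _ (_ , _ , rs' , qs' , rn' , _ , _ , rs'∈A₀ , rn'∈A₁ , _ , _ , _ , _ , refl) (inj₁ (lo , hi))
      with between-block P rs qs rn rs' qs' rn' wf (rs'∈A₀ , rn'∈A₁) lo hi
    ... | refl , k'<j = ∈-applyUpTo⁺ _ (ℕP.<-trans k'<j j<m)
    within _ (_ , _ , rs' , qs' , rn' , _ , _ , rs'∈A₀ , rn'∈A₁ , _ , _ , _ , _ , refl) (inj₂ (lo , hi))
      with between-block P rs qs rn rs' qs' rn' wf (rs'∈A₀ , rn'∈A₁) lo hi
    ... | refl , k'<k = ∈-applyUpTo⁺ _ (ℕP.<-trans k'<k k<m)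

  -- An element of the interval has the frame of x_k (else fresh siblings
  -- would escape any finite cover), hence mentions a and lies in the block.
  interval⊆block : ∀ {k} → k ℕ.< m → ∀ y →
                   InMaxDiscreteInterval P T G (encode rs qs rn k) y → y ∈ block
  interval⊆block {k} k<m _ ((_ , a' , rs' , qs' , rn' , m' , k' , rs'∈A₀ , rn'∈A₁ , classes' ,
                               1≤m' , real' , k'<m' , refl) , cover , covers)
    with separate P rs qs rn k rs' qs' rn' k' wf (rs'∈A₀ , rn'∈A₁) (concat cover)
  ... | inj₁ refl = ∈-applyUpTo⁺ _ (subst (k' ℕ.<_) m'≡m k'<m')
    where
    a'≡a : a' ≡ a
    a'≡a = vec-ext λ i → trans (sym (classes' i)) (classes i)
    m'≡m : m' ≡ m
    m'≡m = listing-index-unique T G a 1≤m' (subst (λ v → Realizes G v (t T m')) a'≡a real') 1≤m real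
  ... | inj₂ (inj₁ (fresh-between z sib x<z z<y w w∈z w∉S)) =
    ⊥-elim (w∉S (∈-concat⁺′ w∈z (covers z (sibling∈L P T G {a = a} {qs} classes 1≤m real k<m sib) (inj₁ (x<z , z<y)))))
  ... | inj₂ (inj₂ (fresh-between z sib y<z z<x w w∈z w∉S)) =
    ⊥-elim (w∉S (∈-concat⁺′ w∈z (covers z (sibling∈L P T G {a = a'} {qs'} classes' 1≤m' real' k'<m' sib) (inj₂ (y<z , z<x)))))

lemma3p3 : (P : Partition) (T : TypeListing) (G : DiGraph)
           (b : List ℚ) {n : ℕ} (a : Vec ℕ n) →
           Mentions P T G b a →
           Σ ℕ λ m → 1 ≤ m × Realizes G a (t T m)
             × MaxDiscreteIntervalSize P T G b m
             × (∀ (m' : ℕ) → 1 ≤ m' → Realizes G a (t T m') → m' ≡ m)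
lemma3p3 P T G _ a (rs , qs , rn , m , k , rs∈A₀ , rn∈A₁ , classes , 1≤m , real , k<m , refl) =
  m , 1≤m , real , interval , λ m' 1≤m' real' → listing-index-unique T G a 1≤m' real' 1≤m real
  where
  open Block P T G {a = a} {rs} {qs} (rs∈A₀ , rn∈A₁) classes 1≤m real
  interval : MaxDiscreteIntervalSize P T G (encode rs qs rn k) m
  interval = block , block-unique , length-applyUpTo _ m ,
             λ y → block⊆interval k<m y , interval⊆block k<m y
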